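{- Every tree $T$ with at least one edge admits an odd-edge graceful-difference total coloring.
   Context: For a tree $T$ with $q\ge1$ edges, $[0,2q-1]=\{0,1,\dots,2q-1\}$ and $[1,2q-1]^o$ is the set of odd integers in $[1,2q-1]$. An odd-edge graceful-difference total coloring of $T$ is a map $h:V(T)\cup E(T)\to[0,2q-1]$ (vertex colors need not be distinct) such that $\{h(e):e\in E(T)\}=[1,2q-1]^o$ and there is a non-negative integer $k$ with $\big||h(u)-h(v)|-h(uv)\big|=k$ for every edge $uv\in E(T)$. -}

module Defs where

open import Data.Nat using (ℕ; zero; suc; _+_; _*_; _∸_; _≤_; _<_; ∣_-_∣)
open import Data.Fin using (Fin)
open import Data.Product using (Σ; ∃; _×_; _,_; proj₁; proj₂)
open import Data.Sum using (_⊎_)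
open import Relation.Binary.PropositionalEquality using (_≡_; _≢_)
open import Relation.Binary.Construct.Closure.ReflexiveTransitive using (Star)

-- A finite simple graph with vertex set Fin n and q edges labelled by Fin q.
-- Each edge is an unordered pair {u , v}, given by a chosen orientation.
record Graph (n q : ℕ) : Set where
  field
    ends : Fin q → Fin n × Fin n

  src : Fin q → Fin n
  src e = proj₁ (ends e)

  tgt : Fin q → Fin n
  tgt e = proj₂ (ends e)

  Adj : Fin n → Fin n → Set
  Adj u v = ∃ λ e → (src e ≡ u × tgt e ≡ v) ⊎ (src e ≡ v × tgt e ≡ u)

open Graph public

IsSimple : ∀ {n q} → Graph n q → Set
IsSimple {n} {q} G =
  (∀ e → src G e ≢ tgt G e) ×
  (∀ e f → ((src G e ≡ src G f × tgt G e ≡ tgt G f) ⊎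
            (src G e ≡ tgt G f × tgt G e ≡ src G f)) → e ≡ f)

IsConnected : ∀ {n q} → Graph n q → Set
IsConnected {n} G = ∀ (u v : Fin n) → Star (Adj G) u v

IsTree : ∀ {n q} → Graph n q → Set
IsTree {n} {q} G = IsSimple G × IsConnected G × n ≡ suc q

Odd : ℕ → Set
Odd m = ∃ λ i → m ≡ suc (2 * i)

record OddEdgeGracefulDifferenceTotalColoring {n q : ℕ} (G : Graph n q) : Set where
  field
    hV : Fin n → ℕ
    hE : Fin q → ℕ
    hV-range : ∀ v → hV v ≤ 2 * q ∸ 1
    hE-range : ∀ e → hE e ≤ 2 * q ∸ 1
    hE-odd : ∀ e → Odd (hE e)
    hE-onto : ∀ m → Odd m → m ≤ 2 * q ∸ 1 → ∃ λ e → hE e ≡ m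
    k : ℕ
    graceful-diff : ∀ e → ∣ ∣ hV (src G e) - hV (tgt G e) ∣ - hE e ∣ ≡ k

-- Grow a spanning subtree one edge at a time, starting from a single vertex
-- colored 0, and give the edges added in turn the differences 2q − 1, 2q − 3,
-- …, 1: the new leaf z adjacent to an already colored vertex x is colored
-- h x ± (2r + 1). One of the two signs stays inside [0, 2q − 1] as long as
-- every colored vertex avoids the open interval (2(q − r − 1), 2r + 1), and
-- the new color avoids the next, narrower interval because differences
-- decrease. After q steps every vertex is colored, the q edges received pairwise
-- distinct odd differences, so all edges were used, and coloring each edge by
-- its difference gives k = 0.
module Submission where

open import Defs
open import Data.Nat using (ℕ; zero; suc; _+_; _*_; _∸_; _≤_; _<_; ∣_-_∣; s≤s; s≤s⁻¹)
open import Data.Nat.Properties hiding (_≟_)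
open import Data.Fin using (Fin; zero; suc; toℕ; fromℕ<; punchOut; _≟_)
open import Data.Fin.Properties using (any?; ¬∀⟶∃¬; injective⇒≤; punchOut-injective; toℕ-injective; toℕ-fromℕ<)
open import Data.Vec.Functional using (Vector; _∷_; updateAt)
open import Data.Vec.Functional.Properties using (updateAt-updates; updateAt-minimal)
open import Data.Product using (∃; ∃₂; _×_; _,_; proj₁; proj₂; map)
open import Data.Sum using (_⊎_; inj₁; inj₂)
open import Function using (const)
open import Function.Definitions using (Injective)
open import Level using (0ℓ)
open import Relation.Binary using (Rel)
open import Relation.Binary.Construct.Closure.ReflexiveTransitive using (Star; ε; _◅_)
open import Relation.Binary.PropositionalEquality
open import Relation.Nullary using (¬_; yes; no; contradiction)
open import Relation.Unary using (Pred; Decidable)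

<⇒≤∸1 : ∀ {m n} → m < n → m ≤ n ∸ 1
<⇒≤∸1 (s≤s m≤n) = m≤n

surjective⇒≤ : ∀ {m n} (f : Fin m → Fin n) → (∀ y → ∃ λ x → f x ≡ y) → n ≤ m
surjective⇒≤ f surj = injective⇒≤ {f = λ y → proj₁ (surj y)} section-injective
  where
    section-injective : ∀ {a b} → proj₁ (surj a) ≡ proj₁ (surj b) → a ≡ b
    section-injective {a} {b} eq =
      trans (sym (proj₂ (surj a))) (trans (cong f eq) (proj₂ (surj b)))

injective⇒surjective : ∀ {n} {f : Fin n → Fin n} → Injective _≡_ _≡_ f →
                       ∀ y → ∃ λ x → f x ≡ y
injective⇒surjective {suc m} {f} f-injective y with any? (λ x → f x ≟ y)
... | yes hit = hit
... | no missed = contradiction (injective⇒≤ squeezed-injective) 1+n≰n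
  where
    squeezed : Fin (suc m) → Fin m
    squeezed x = punchOut {i = y} (λ eq → missed (x , sym eq))

    squeezed-injective : ∀ {a b} → squeezed a ≡ squeezed b → a ≡ b
    squeezed-injective eq = f-injective (punchOut-injective {i = y} _ _ eq)

InImage : ∀ {m n} → (Fin m → Fin n) → Fin n → Set
InImage f w = ∃ λ k → f k ≡ w

inImage? : ∀ {m n} (f : Fin m → Fin n) → Decidable (InImage f)
inImage? f w = any? (λ k → f k ≟ w)

star-crossing : ∀ {a ℓ p} {A : Set a} {R : Rel A ℓ} {P : Pred A p} → Decidable P →
                ∀ {x y} → Star R x y → P x → ¬ P y → ∃₂ λ u v → P u × ¬ P v × R u v
star-crossing P? ε Px ¬Py = contradiction Px ¬Py
star-crossing P? {x} (_◅_ {j = v} xRv path) Px ¬Py with P? v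
... | yes Pv = star-crossing P? path Pv ¬Py
... | no ¬Pv = x , v , Px , ¬Pv , xRv

updateAt-preserves : ∀ {n} {P : Pred ℕ 0ℓ} (h : Vector ℕ n) z {y} →
                     (∀ w → P (h w)) → P y → ∀ w → P (updateAt h z (const y) w)
updateAt-preserves {P = P} h z Ph Py w with w ≟ z
... | yes refl = subst P (sym (updateAt-updates w h)) Py
... | no w≢z = subst P (sym (updateAt-minimal w z h w≢z)) (Ph w)

-- A vertex colored x still has room for a neighbour at distance 2r − 1 within
-- [0, 2q − 1]; written without subtraction so that r = 0 is harmless.
Extendable : ℕ → ℕ → ℕ → Set
Extendable q r x = x + 2 * r ≤ 2 * q ⊎ 2 * r ≤ suc x

extendable-pred : ∀ {q r x} → Extendable q (suc r) x → Extendable q r x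
extendable-pred {r = r} {x} (inj₁ up) = inj₁ (≤-trans (+-monoʳ-≤ x (*-monoʳ-≤ 2 (n≤1+n r))) up)
extendable-pred {r = r} (inj₂ down) = inj₂ (≤-trans (*-monoʳ-≤ 2 (n≤1+n r)) down)

extend : ∀ {q r x} → x < 2 * q → Extendable q (suc r) x →
         ∃ λ y → y < 2 * q × Extendable q r y × ∣ x - y ∣ ≡ suc (2 * r)
extend {q} {r} {x} x< (inj₁ up) =
  x + d , subst (_≤ 2 * q) shift up ,
  inj₂ (≤-trans (n≤1+n (2 * r)) (m≤n+m d (suc x))) , ∣m-m+n∣≡n x d
  where
    d = suc (2 * r)
    shift : x + 2 * suc r ≡ suc (x + d)
    shift = trans (cong (x +_) (*-suc 2 r)) (+-suc x d)
extend {q} {r} {x} x< (inj₂ down) =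
  x ∸ d , ≤-<-trans (m∸n≤m x d) x< , inj₁ (<⇒≤ (<-trans below x<)) ,
  trans (m≤n⇒∣n-m∣≡n∸m (m∸n≤m x d)) (m∸[m∸n]≡n d≤x)
  where
    d = suc (2 * r)
    d≤x : d ≤ x
    d≤x = s≤s⁻¹ (subst (_≤ suc x) (*-suc 2 r) down)
    below : x ∸ d + 2 * r < x
    below = subst (x ∸ d + 2 * r <_) (m∸n+n≡m d≤x) (+-monoʳ-< (x ∸ d) (n<1+n (2 * r)))

module Growth {q} (G : Graph (suc q) q) (connected : IsConnected G) where

  Joins : Fin q → Fin (suc q) → Fin (suc q) → Set
  Joins e x z = (src G e ≡ x × tgt G e ≡ z) ⊎ (src G e ≡ z × tgt G e ≡ x)

  difference : (Fin (suc q) → ℕ) → Fin q → ℕ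
  difference h e = ∣ h (src G e) - h (tgt G e) ∣

  difference-joins : ∀ h {e x z} → Joins e x z → difference h e ≡ ∣ h x - h z ∣
  difference-joins h (inj₁ (refl , refl)) = refl
  difference-joins h (inj₂ (refl , refl)) = ∣-∣-comm (h _) (h _)

  joins-ends : ∀ {P : Pred (Fin (suc q)) 0ℓ} {e x z} → Joins e x z →
               P x → P z → P (src G e) × P (tgt G e)
  joins-ends (inj₁ (refl , refl)) Px Pz = Px , Pz
  joins-ends (inj₂ (refl , refl)) Px Pz = Pz , Px

  frontier : ∀ {i} (vertex : Fin (suc i) → Fin (suc q)) → suc i ≤ q →
             ∃₂ λ x z → InImage vertex x × ¬ InImage vertex z × ∃ λ e → Joins e x z
  frontier vertex room =
    star-crossing (inImage? vertex) (connected (vertex zero) z) (zero , refl) ¬z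
    where
      missing : ∃ λ w → ¬ InImage vertex w
      missing = ¬∀⟶∃¬ (suc q) (InImage vertex) (inImage? vertex)
                  (λ all → <⇒≱ room (s≤s⁻¹ (surjective⇒≤ vertex all)))
      z = proj₁ missing
      ¬z = proj₂ missing

  record Partial (i r : ℕ) : Set where
    field
      vertex : Fin (suc i) → Fin (suc q)
      edge : Fin i → Fin q
      h : Fin (suc q) → ℕ
      h< : ∀ w → h w < 2 * q
      extendable : ∀ {w} → InImage vertex w → Extendable q r (h w)
      edge-placed : ∀ j → InImage vertex (src G (edge j)) × InImage vertex (tgt G (edge j))
      edge-difference : ∀ j → difference h (edge j) ≡ suc (2 * (r + toℕ j))

  start : 1 ≤ q → Partial 0 q
  start q≥1 = record
    { vertex = const zero
    ; edge = λ ()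
    ; h = const 0
    ; h< = const (≤-trans q≥1 (m≤m+n q (q + 0)))
    ; extendable = const (inj₁ ≤-refl)
    ; edge-placed = λ ()
    ; edge-difference = λ ()
    }

  step : ∀ {i r} → Partial i (suc r) → suc i ≤ q → Partial (suc i) r
  step {i} {r} s room with frontier (Partial.vertex s) room
  ... | x , z , placed-x , unplaced-z , e , joins = record
    { vertex = z ∷ vertex
    ; edge = e ∷ edge
    ; h = h′
    ; h< = updateAt-preserves {P = _< 2 * q} h z h< y<
    ; extendable = extendable′
    ; edge-placed = edge-placed′
    ; edge-difference = edge-difference′
    }
    where
      open Partial s
      new = extend {q = q} (h< x) (extendable placed-x)
      y = proj₁ new
      y< = proj₁ (proj₂ new)
      y-extendable = proj₁ (proj₂ (proj₂ new))
      y-distance = proj₂ (proj₂ (proj₂ new))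

      h′ : Fin (suc q) → ℕ
      h′ = updateAt h z (const y)

      h′z : h′ z ≡ y
      h′z = updateAt-updates z h

      h′-placed : ∀ {w} → InImage vertex w → h′ w ≡ h w
      h′-placed {w} placed = updateAt-minimal w z h (λ { refl → unplaced-z placed })

      lift : ∀ {w} → InImage vertex w → InImage (z ∷ vertex) w
      lift (k , eq) = suc k , eq

      extendable′ : ∀ {w} → InImage (z ∷ vertex) w → Extendable q r (h′ w)
      extendable′ (zero , refl) = subst (Extendable q r) (sym h′z) y-extendable
      extendable′ (suc k , refl) = subst (Extendable q r) (sym (h′-placed (k , refl)))
                                     (extendable-pred {q = q} (extendable (k , refl)))

      edge-placed′ : ∀ j → InImage (z ∷ vertex) (src G ((e ∷ edge) j)) ×
                           InImage (z ∷ vertex) (tgt G ((e ∷ edge) j))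
      edge-placed′ zero = joins-ends {P = InImage (z ∷ vertex)} joins (lift placed-x) (zero , refl)
      edge-placed′ (suc j) = map lift lift (edge-placed j)

      edge-difference′ : ∀ j → difference h′ ((e ∷ edge) j) ≡ suc (2 * (r + toℕ j))
      edge-difference′ zero = begin
        difference h′ e      ≡⟨ difference-joins h′ joins ⟩
        ∣ h′ x - h′ z ∣      ≡⟨ cong₂ ∣_-_∣ (h′-placed placed-x) h′z ⟩
        ∣ h x - y ∣          ≡⟨ y-distance ⟩
        suc (2 * r)          ≡⟨ cong (λ t → suc (2 * t)) (sym (+-identityʳ r)) ⟩
        suc (2 * (r + 0))    ∎
        where open ≡-Reasoning
      edge-difference′ (suc j) = begin
        difference h′ (edge j)           ≡⟨ cong₂ ∣_-_∣ (h′-placed (proj₁ (edge-placed j)))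
                                                       (h′-placed (proj₂ (edge-placed j))) ⟩
        difference h (edge j)            ≡⟨ edge-difference j ⟩
        suc (2 * (suc r + toℕ j))        ≡⟨ cong (λ t → suc (2 * t)) (sym (+-suc r (toℕ j))) ⟩
        suc (2 * (r + suc (toℕ j)))      ∎
        where open ≡-Reasoning

  grow : ∀ r {i} → i + r ≡ q → Partial i r → Partial q 0
  grow zero {i} i+0≡q s = subst (λ t → Partial t 0) (trans (sym (+-identityʳ i)) i+0≡q) s
  grow (suc r) {i} i+[1+r]≡q s =
    grow r [1+i]+r≡q (step s (≤-trans (s≤s (m≤m+n i r)) (≤-reflexive [1+i]+r≡q)))
    where
      [1+i]+r≡q : suc i + r ≡ q
      [1+i]+r≡q = trans (sym (+-suc i r)) i+[1+r]≡q

  coloring : 1 ≤ q → OddEdgeGracefulDifferenceTotalColoring G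
  coloring q≥1 = record
    { hV = h
    ; hE = difference h
    ; hV-range = λ w → <⇒≤∸1 (h< w)
    ; hE-range = λ e → ≤-trans (∣m-n∣≤m⊔n (h (src G e)) (h (tgt G e)))
                                (⊔-lub (<⇒≤∸1 (h< (src G e))) (<⇒≤∸1 (h< (tgt G e))))
    ; hE-odd = odd
    ; hE-onto = onto
    ; k = 0
    ; graceful-diff = λ e → ∣n-n∣≡0 (difference h e)
    }
    where
      open Partial (grow q refl (start q≥1))

      edge-injective : Injective _≡_ _≡_ edge
      edge-injective {a} {b} eq = toℕ-injective (*-cancelˡ-≡ (toℕ a) (toℕ b) 2 (suc-injective
        (trans (sym (edge-difference a)) (trans (cong (difference h) eq) (edge-difference b)))))

      odd : ∀ e → Odd (difference h e)
      odd e with injective⇒surjective edge-injective e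
      ... | j , refl = toℕ j , edge-difference j

      onto : ∀ m → Odd m → m ≤ 2 * q ∸ 1 → ∃ λ e → difference h e ≡ m
      onto m (a , refl) m≤ =
        edge (fromℕ< a<q) , trans (edge-difference _) (cong (λ t → suc (2 * t)) (toℕ-fromℕ< a<q))
        where
          a<q : a < q
          a<q = *-cancelˡ-< 2 a q (≤-trans m≤ (m∸n≤m (2 * q) 1))

mainTheorem8 : ∀ {n q : ℕ} (T : Graph n q) → IsTree T → 1 ≤ q →
    OddEdgeGracefulDifferenceTotalColoring T
mainTheorem8 T (_ , connected , refl) q≥1 = Growth.coloring T connected q≥1
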